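{- Let $G$ be a graph and $V_s, V_t$ vertex covers of $G$ of the same size. There exists a reconfiguration sequence from $V_s$ to $V_t$ under relaxed token jumping if and only if there exists a reconfiguration sequence from $V_s$ to $V_t$ under Token Jumping.
   Context: Under Token Jumping, configurations are sets of $|V_s|$ vertices, every configuration must be a vertex cover, and a move removes one token from a vertex and places it on any unoccupied vertex. Under relaxed token jumping, configurations may be multisets of vertices (several tokens may occupy one vertex); each move consists of several simultaneous steps, each being a removal of a token from a vertex, an addition of a token to a vertex, or a jump of a token from one vertex to another (possibly occupied) vertex. Every intermediate configuration $V_i$ must be a vertex cover (its support covers all edges) with $|V_i|\leq |V_s|$, and in a move performed from configuration $V_i$ at most $|V_s|-|V_i|$ additions are made, and at most $|V_s|-|V_i|+1$ jumps and additions are made in total. The sequence starts at $V_s$ and ends at $V_t$. -}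

module Defs where

open import Data.Nat using (ℕ; zero; suc; _+_; _∸_; _≤_; _<_)
open import Data.Bool using (Bool; true; false; if_then_else_)
open import Data.Fin using (Fin)
open import Data.Fin.Properties using (_≟_)
open import Data.Fin.Subset using (Subset; _∈_; _∉_; ∣_∣)
open import Data.Vec using (Vec; lookup; tabulate; map; sum; _[_]≔_)
open import Data.List using (List; []; _∷_)
open import Data.Product using (Σ; _×_; ∃; ∃-syntax)
open import Data.Sum using (_⊎_)
open import Relation.Binary.PropositionalEquality using (_≡_; _≢_)
open import Relation.Nullary using (¬_; does)

record Graph (n : ℕ) : Set₁ where
  field
    Edge   : Fin n → Fin n → Set
    sym    : ∀ {u v} → Edge u v → Edge v u
    irrefl : ∀ {u} → ¬ Edge u u
open Graph public

IsVertexCover : ∀ {n} → Graph n → Subset n → Set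
IsVertexCover G A = ∀ u v → Edge G u v → u ∈ A ⊎ v ∈ A

TJMove : ∀ {n} → Subset n → Subset n → Set
TJMove {n} A B = Σ (Fin n) λ u → Σ (Fin n) λ v →
  u ∈ A × v ∉ A × B ≡ (A [ u ]≔ false) [ v ]≔ true

data TJSeq {n} (G : Graph n) : Subset n → Subset n → Set where
  done : ∀ {A} → IsVertexCover G A → TJSeq G A A
  step : ∀ {A B C} → IsVertexCover G A → TJMove A B → TJSeq G B C → TJSeq G A C

-- Relaxed token jumping (configurations are multisets of vertices,
-- represented by multiplicity vectors)

Multiset : ℕ → Set
Multiset n = Vec ℕ n

size : ∀ {n} → Multiset n → ℕ
size = sum

toMultiset : ∀ {n} → Subset n → Multiset n
toMultiset = map (λ b → if b then 1 else 0)

IsVertexCoverᴹ : ∀ {n} → Graph n → Multiset n → Set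
IsVertexCoverᴹ G M = ∀ u v → Edge G u v → 0 < lookup M u ⊎ 0 < lookup M v

data Step (n : ℕ) : Set where
  remove : Fin n → Step n
  add    : Fin n → Step n
  jump   : (u v : Fin n) → u ≢ v → Step n

[_≟ᵇ_] : ∀ {n} → Fin n → Fin n → ℕ
[ u ≟ᵇ v ] = if does (u ≟ v) then 1 else 0

outAt : ∀ {n} → List (Step n) → Fin n → ℕ
outAt []                  w = 0
outAt (remove u     ∷ ss) w = [ u ≟ᵇ w ] + outAt ss w
outAt (add _        ∷ ss) w = outAt ss w
outAt (jump u _ _   ∷ ss) w = [ u ≟ᵇ w ] + outAt ss w

inAt : ∀ {n} → List (Step n) → Fin n → ℕ
inAt []                  w = 0
inAt (remove _     ∷ ss) w = inAt ss w
inAt (add v        ∷ ss) w = [ v ≟ᵇ w ] + inAt ss w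
inAt (jump _ v _   ∷ ss) w = [ v ≟ᵇ w ] + inAt ss w

#additions : ∀ {n} → List (Step n) → ℕ
#additions []             = 0
#additions (add _ ∷ ss)   = suc (#additions ss)
#additions (_     ∷ ss)   = #additions ss

#jumps : ∀ {n} → List (Step n) → ℕ
#jumps []                = 0
#jumps (jump _ _ _ ∷ ss) = suc (#jumps ss)
#jumps (_          ∷ ss) = #jumps ss

-- a relaxed move from M to M' (k = |V_s|): the steps are performed
-- simultaneously, every removed/jumping token exists, at most k - |M|
-- additions, at most k - |M| + 1 jumps and additions in total
RelaxedMove : ∀ {n} → ℕ → Multiset n → Multiset n → Set
RelaxedMove {n} k M M' = ∃[ ss ]
  ( (∀ w → outAt ss w ≤ lookup M w)
  × M' ≡ tabulate (λ w → lookup M w + inAt ss w ∸ outAt ss w)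
  × #additions ss ≤ k ∸ size M
  × #jumps ss + #additions ss ≤ suc (k ∸ size M) )

data RelaxedSeq {n} (G : Graph n) (k : ℕ) : Multiset n → Multiset n → Set where
  done : ∀ {M} → IsVertexCoverᴹ G M → size M ≤ k → RelaxedSeq G k M M
  step : ∀ {M M' M''} → IsVertexCoverᴹ G M → size M ≤ k →
         RelaxedMove k M M' → RelaxedSeq G k M' M'' → RelaxedSeq G k M M''

{-# OPTIONS --safe #-}
-- A Token Jumping move is a relaxed move consisting of a single jump, so
-- one direction is immediate. Conversely, follow a relaxed sequence with a
-- set A of k = |V_s| tokens containing the support of the current multiset
-- M; A is then a vertex cover. For a relaxed move M → M′ every vertex of
-- supp M ∪ supp M′ holds a token of M or receives one, and at most
-- k − |M| + 1 tokens are received, so |supp M ∪ supp M′| ≤ k + 1. While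
-- supp M′ ⊄ A, jump a token of A onto some v ∈ supp M′ ∖ A, taking it from
-- outside supp M ∪ supp M′ if possible (so that A still contains supp M).
-- Otherwise A ⊆ supp M ∪ supp M′, and the bound k + 1 forces
-- supp M′ ⊆ A − u + v for any u ∈ A ∖ supp M′. At the end V_t ⊆ A and
-- |A| = |V_t| give A = V_t.

module Submission where

open import Defs hiding (sym)
open import Data.Bool using (if_then_else_)
open import Data.Fin using (Fin; zero; suc)
open import Data.Fin.Properties using (_≟_)
open import Data.Fin.Subset
  using (Subset; inside; outside; _∈_; _∉_; _⊆_; ∣_∣; _∪_; _∩_; ∁; ⁅_⁆; Nonempty; Empty)
open import Data.Fin.Subset.Properties
  using (_∈?_; nonempty?; p⊆q⇒∣p∣≤∣q∣; p⊂q⇒∣p∣<∣q∣; ⊆-reflexive; ⊆-trans; ⊆-antisym; p⊆p∪q; q⊆p∪q;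
         x∈p∪q⁻; x∈p∩q⁺; x∈p∩q⁻; x∉p⇒x∈∁p; x∈∁p⇒x∉p; x∈⁅x⁆; x∈⁅y⁆⇒x≡y)
open import Data.List using (List; []; _∷_)
open import Data.Nat using (ℕ; zero; suc; _+_; _∸_; _≤_; _<_; _<ᵇ_; z≤n; s≤s; z<s)
open import Data.Nat.Induction using (<-wellFounded)
open import Data.Nat.Properties
  using (≤-refl; ≤-reflexive; ≤-trans; <-≤-trans; <⇒≱; m≤m+n; m≤n+m; m∸n≤m;
         m+n∸n≡m; m+[n∸m]≡n; +-suc; +-identityʳ; +-monoʳ-≤; +-0-commutativeMonoid;
         module ≤-Reasoning)
open import Algebra.Properties.CommutativeMonoid.Sum +-0-commutativeMonoid
  using (∑-distrib-+; sum-cong-≗; sum-replicate-zero) renaming (sum to ∑)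
open import Data.Product using (_×_; _,_; proj₂; ∃-syntax)
open import Data.Sum using (inj₁; inj₂; [_,_]′) renaming (map to ⊎-map)
open import Data.Vec using ([]; _∷_; lookup; tabulate; map; _[_]≔_; here; there)
open import Data.Vec.Properties
  using (lookup-map; lookup∘tabulate; tabulate∘lookup; tabulate-cong; lookup∘update; lookup∘update′;
         []≔-updates; []≔-minimal; []=⇒lookup; lookup⇒[]=)
open import Function using (_∘_; _⇔_; mk⇔; Equivalence)
open import Induction.WellFounded using (Acc; acc)
open import Relation.Binary.Construct.Closure.ReflexiveTransitive using (Star; ε; _◅_; _◅◅_)
open import Relation.Binary.PropositionalEquality
  using (_≡_; _≢_; refl; sym; trans; cong; cong₂; subst; module ≡-Reasoning)
open import Relation.Nullary using (yes; no)
open import Relation.Nullary.Decidable using (decidable-stable)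
open import Relation.Nullary.Negation using (contradiction)

private
  variable
    n k : ℕ
    p q r : Subset n

∪-least : p ⊆ r → q ⊆ r → p ∪ q ⊆ r
∪-least {p = p} {q = q} p⊆r q⊆r x∈p∪q = [ p⊆r , q⊆r ]′ (x∈p∪q⁻ p q x∈p∪q)

x∈p∩∁q⁺ : ∀ {x} → x ∈ p → x ∉ q → x ∈ p ∩ ∁ q
x∈p∩∁q⁺ x∈p x∉q = x∈p∩q⁺ (x∈p , x∉p⇒x∈∁p x∉q)

x∈p∩∁q⁻ : ∀ {x} → x ∈ p ∩ ∁ q → x ∈ p × x ∉ q
x∈p∩∁q⁻ {p = p} {q = q} x∈p∩∁q with x∈p∩q⁻ p (∁ q) x∈p∩∁q
... | x∈p , x∈∁q = x∈p , x∈∁p⇒x∉p x∈∁q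

Empty[p∩∁q]⇒p⊆q : Empty (p ∩ ∁ q) → p ⊆ q
Empty[p∩∁q]⇒p⊆q {q = q} empty {x} x∈p =
  decidable-stable (x ∈? q) (λ x∉q → empty (x , x∈p∩∁q⁺ x∈p x∉q))

p⊆q∧∣q∣≤∣p∣⇒q⊆p : p ⊆ q → ∣ q ∣ ≤ ∣ p ∣ → q ⊆ p
p⊆q∧∣q∣≤∣p∣⇒q⊆p {p = p} p⊆q ∣q∣≤∣p∣ {x} x∈q =
  decidable-stable (x ∈? p) (λ x∉p → <⇒≱ (p⊂q⇒∣p∣<∣q∣ (p⊆q , x , x∈q , x∉p)) ∣q∣≤∣p∣)

x∈p⇒⁅x⁆⊆p : ∀ {x} → x ∈ p → ⁅ x ⁆ ⊆ p
x∈p⇒⁅x⁆⊆p {p = p} {x} x∈p y∈⁅x⁆ = subst (_∈ p) (sym (x∈⁅y⁆⇒x≡y x y∈⁅x⁆)) x∈p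

x∉p⇒∣p∣<∣p∪⁅x⁆∣ : ∀ {x} → x ∉ p → ∣ p ∣ < ∣ p ∪ ⁅ x ⁆ ∣
x∉p⇒∣p∣<∣p∪⁅x⁆∣ {p = p} {x} x∉p =
  p⊂q⇒∣p∣<∣q∣ (p⊆p∪q ⁅ x ⁆ , x , q⊆p∪q p ⁅ x ⁆ (x∈⁅x⁆ x) , x∉p)

x∉p⇒lookup≡outside : ∀ {x} → x ∉ p → lookup p x ≡ outside
x∉p⇒lookup≡outside {p = p} {x} x∉p with lookup p x in eq
... | outside = refl
... | inside  = contradiction (lookup⇒[]= x p eq) x∉p

∣p[x]≔inside∣ : ∀ {x} → x ∉ p → ∣ p [ x ]≔ inside ∣ ≡ suc ∣ p ∣
∣p[x]≔inside∣ {p = outside ∷ p} {zero}  x∉p = refl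
∣p[x]≔inside∣ {p = inside  ∷ p} {zero}  x∉p = contradiction here x∉p
∣p[x]≔inside∣ {p = outside ∷ p} {suc x} x∉p = ∣p[x]≔inside∣ (x∉p ∘ there)
∣p[x]≔inside∣ {p = inside  ∷ p} {suc x} x∉p = cong suc (∣p[x]≔inside∣ (x∉p ∘ there))

∣p[x]≔outside∣ : ∀ {x} → x ∈ p → suc ∣ p [ x ]≔ outside ∣ ≡ ∣ p ∣
∣p[x]≔outside∣ {p = inside  ∷ p} here        = refl
∣p[x]≔outside∣ {p = outside ∷ p} (there x∈p) = ∣p[x]≔outside∣ x∈p
∣p[x]≔outside∣ {p = inside  ∷ p} (there x∈p) = cong suc (∣p[x]≔outside∣ x∈p)

p[x]≔outside⊆p : ∀ {x} → p [ x ]≔ outside ⊆ p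
p[x]≔outside⊆p {p = _ ∷ _} {zero}  (there y∈p) = there y∈p
p[x]≔outside⊆p {p = _ ∷ _} {suc x} here        = here
p[x]≔outside⊆p {p = _ ∷ _} {suc x} (there y∈p) = there (p[x]≔outside⊆p y∈p)

moveToken : Subset n → Fin n → Fin n → Subset n
moveToken A u v = (A [ u ]≔ outside) [ v ]≔ inside

module _ {A : Subset n} {u v : Fin n} where

  v∈moveToken : v ∈ moveToken A u v
  v∈moveToken = []≔-updates (A [ u ]≔ outside) v

  ∈-moveToken : ∀ {x} → x ∈ A → x ≢ u → x ∈ moveToken A u v
  ∈-moveToken {x} x∈A x≢u with x ≟ v
  ... | yes refl = v∈moveToken
  ... | no x≢v   = []≔-minimal _ x v x≢v ([]≔-minimal A x u x≢u x∈A)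

  moveToken-⊇ : ∀ {B} → B ⊆ A ∪ ⁅ v ⁆ → u ∉ B → B ⊆ moveToken A u v
  moveToken-⊇ B⊆A∪v u∉B {x} x∈B with x∈p∪q⁻ A ⁅ v ⁆ (B⊆A∪v x∈B)
  ... | inj₁ x∈A = ∈-moveToken x∈A λ { refl → u∉B x∈B }
  ... | inj₂ x∈v = subst (_∈ moveToken A u v) (sym (x∈⁅y⁆⇒x≡y v x∈v)) v∈moveToken

  ∣moveToken∣ : u ∈ A → v ∉ A → ∣ moveToken A u v ∣ ≡ ∣ A ∣
  ∣moveToken∣ u∈A v∉A =
    trans (∣p[x]≔inside∣ (v∉A ∘ p[x]≔outside⊆p)) (∣p[x]≔outside∣ u∈A)

  ∣T∩∁moveToken∣<∣T∩∁A∣ : ∀ {T} → u ∉ T → v ∈ T → v ∉ A →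
                          ∣ T ∩ ∁ (moveToken A u v) ∣ < ∣ T ∩ ∁ A ∣
  ∣T∩∁moveToken∣<∣T∩∁A∣ {T} u∉T v∈T v∉A = p⊂q⇒∣p∣<∣q∣
    (missing , v , x∈p∩∁q⁺ v∈T v∉A , λ v∈T∖A′ → proj₂ (x∈p∩∁q⁻ {p = T} v∈T∖A′) v∈moveToken)
    where
    missing : T ∩ ∁ (moveToken A u v) ⊆ T ∩ ∁ A
    missing x∈T∖A′ with x∈p∩∁q⁻ x∈T∖A′
    ... | x∈T , x∉A′ = x∈p∩∁q⁺ x∈T λ x∈A → x∉A′ (∈-moveToken x∈A λ { refl → u∉T x∈T })

moveToken-TJMove : ∀ {A : Subset n} {u v} → u ∈ A → v ∉ A → TJMove A (moveToken A u v)
moveToken-TJMove u∈A v∉A = _ , _ , u∈A , v∉A , refl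

TJPath : Graph n → Subset n → Subset n → Set
TJPath G = Star (λ A B → IsVertexCover G A × TJMove A B)

TJPath-◅◅-TJSeq : ∀ {G : Graph n} {A B C} → TJPath G A B → TJSeq G B C → TJSeq G A C
TJPath-◅◅-TJSeq ε                 seq = seq
TJPath-◅◅-TJSeq ((cov , mv) ◅ path) seq = step cov mv (TJPath-◅◅-TJSeq path seq)

IsVertexCover-mono : ∀ {G : Graph n} {A B} → A ⊆ B → IsVertexCover G A → IsVertexCover G B
IsVertexCover-mono A⊆B cov u v e = ⊎-map A⊆B A⊆B (cov u v e)

TJReachesSuperset : Graph n → ℕ → Subset n → Subset n → Set
TJReachesSuperset G k A T = ∃[ B ] T ⊆ B × ∣ B ∣ ≡ k × TJPath G A B

module _ (G : Graph n) {S T : Subset n}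
         (S-cover : IsVertexCover G S) (∣S∪T∣≤1+k : ∣ S ∪ T ∣ ≤ suc k) (∣T∣≤k : ∣ T ∣ ≤ k) where

  private
    coveredJump : ∀ {A u v} → S ⊆ A → u ∈ A → v ∉ A →
                  IsVertexCover G A × TJMove A (moveToken A u v)
    coveredJump S⊆A u∈A v∉A = IsVertexCover-mono {G = G} S⊆A S-cover , moveToken-TJMove u∈A v∉A

    some-token-outside-T : ∀ {A v} → ∣ A ∣ ≡ k → v ∈ T → v ∉ A → Nonempty (A ∩ ∁ T)
    some-token-outside-T {A} ∣A∣≡k v∈T v∉A =
      decidable-stable (nonempty? (A ∩ ∁ T)) λ A∖T-empty →
        <⇒≱ (p⊂q⇒∣p∣<∣q∣ (Empty[p∩∁q]⇒p⊆q A∖T-empty , _ , v∈T , v∉A))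
            (≤-trans ∣T∣≤k (≤-reflexive (sym ∣A∣≡k)))

    last-jump-covers-T : ∀ {A u v} → ∣ A ∣ ≡ k → A ⊆ S ∪ T → u ∉ T → v ∈ T → v ∉ A →
                         T ⊆ moveToken A u v
    last-jump-covers-T {A} {v = v} ∣A∣≡k A⊆S∪T u∉T v∈T v∉A =
      moveToken-⊇ (⊆-trans (q⊆p∪q S T) S∪T⊆A∪v) u∉T
      where
      ∣S∪T∣≤∣A∪v∣ : ∣ S ∪ T ∣ ≤ ∣ A ∪ ⁅ v ⁆ ∣
      ∣S∪T∣≤∣A∪v∣ = ≤-trans ∣S∪T∣≤1+k (subst (_< ∣ A ∪ ⁅ v ⁆ ∣) ∣A∣≡k (x∉p⇒∣p∣<∣p∪⁅x⁆∣ v∉A))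
      S∪T⊆A∪v : S ∪ T ⊆ A ∪ ⁅ v ⁆
      S∪T⊆A∪v = p⊆q∧∣q∣≤∣p∣⇒q⊆p (∪-least A⊆S∪T (x∈p⇒⁅x⁆⊆p (q⊆p∪q S T v∈T))) ∣S∪T∣≤∣A∪v∣

    reachAcc : ∀ A → S ⊆ A → ∣ A ∣ ≡ k → Acc _<_ ∣ T ∩ ∁ A ∣ → TJReachesSuperset G k A T
    reachAcc A S⊆A ∣A∣≡k (acc rec) with nonempty? (T ∩ ∁ A)
    ... | no T∖A-empty = A , Empty[p∩∁q]⇒p⊆q T∖A-empty , ∣A∣≡k , ε
    ... | yes (v , v∈T∖A) with x∈p∩∁q⁻ v∈T∖A | nonempty? (A ∩ ∁ (S ∪ T))
    ...   | v∈T , v∉A | yes (u , u∈A∖S∪T) with x∈p∩∁q⁻ u∈A∖S∪T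
    ...     | u∈A , u∉S∪T with reachAcc (moveToken A u v)
                                 (moveToken-⊇ (⊆-trans S⊆A (p⊆p∪q ⁅ v ⁆)) (u∉S∪T ∘ p⊆p∪q T))
                                 (trans (∣moveToken∣ u∈A v∉A) ∣A∣≡k)
                                 (rec (∣T∩∁moveToken∣<∣T∩∁A∣ (u∉S∪T ∘ q⊆p∪q S T) v∈T v∉A))
    ...       | B , T⊆B , ∣B∣≡k , path = B , T⊆B , ∣B∣≡k , coveredJump S⊆A u∈A v∉A ◅ path
    reachAcc A S⊆A ∣A∣≡k _ | yes (v , _) | v∈T , v∉A | no A∖S∪T-empty
      with some-token-outside-T ∣A∣≡k v∈T v∉A
    ... | u , u∈A∖T with x∈p∩∁q⁻ u∈A∖T
    ...   | u∈A , u∉T =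
      moveToken A u v ,
      last-jump-covers-T ∣A∣≡k (Empty[p∩∁q]⇒p⊆q A∖S∪T-empty) u∉T v∈T v∉A ,
      trans (∣moveToken∣ u∈A v∉A) ∣A∣≡k ,
      coveredJump S⊆A u∈A v∉A ◅ ε

  reachSuperset : ∀ A → S ⊆ A → ∣ A ∣ ≡ k → TJReachesSuperset G k A T
  reachSuperset A S⊆A ∣A∣≡k = reachAcc A S⊆A ∣A∣≡k (<-wellFounded _)

support : Multiset n → Subset n
support = map (0 <ᵇ_)

∈-support⁺ : ∀ {M : Multiset n} {x} → 0 < lookup M x → x ∈ support M
∈-support⁺ {M = suc _ ∷ _} {zero}  _   = here
∈-support⁺ {M = _ ∷ _}     {suc x} 0<m = there (∈-support⁺ 0<m)

∈-support⁻ : ∀ {M : Multiset n} {x} → x ∈ support M → 0 < lookup M x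
∈-support⁻ {M = suc _ ∷ _} here        = z<s
∈-support⁻ {M = zero  ∷ _} (there x∈M) = ∈-support⁻ x∈M
∈-support⁻ {M = suc _ ∷ _} (there x∈M) = ∈-support⁻ x∈M

support-mono : ∀ {M N : Multiset n} → (∀ x → lookup M x ≤ lookup N x) → support M ⊆ support N
support-mono M≤N {x} x∈M = ∈-support⁺ (<-≤-trans (∈-support⁻ x∈M) (M≤N x))

support-toMultiset : ∀ (A : Subset n) → support (toMultiset A) ≡ A
support-toMultiset []            = refl
support-toMultiset (outside ∷ A) = cong (outside ∷_) (support-toMultiset A)
support-toMultiset (inside  ∷ A) = cong (inside ∷_) (support-toMultiset A)

size-toMultiset : ∀ (A : Subset n) → size (toMultiset A) ≡ ∣ A ∣
size-toMultiset []            = refl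
size-toMultiset (outside ∷ A) = size-toMultiset A
size-toMultiset (inside  ∷ A) = cong suc (size-toMultiset A)

∣support∣≤size : ∀ (M : Multiset n) → ∣ support M ∣ ≤ size M
∣support∣≤size []          = z≤n
∣support∣≤size (zero  ∷ M) = ∣support∣≤size M
∣support∣≤size (suc m ∷ M) = s≤s (≤-trans (∣support∣≤size M) (m≤n+m (size M) m))

IsVertexCoverᴹ⇔IsVertexCover-support : ∀ (G : Graph n) M →
                                       IsVertexCoverᴹ G M ⇔ IsVertexCover G (support M)
IsVertexCoverᴹ⇔IsVertexCover-support G M = mk⇔
  (λ cov u v e → ⊎-map ∈-support⁺ ∈-support⁺ (cov u v e))
  (λ cov u v e → ⊎-map ∈-support⁻ ∈-support⁻ (cov u v e))

size≡∑lookup : ∀ (M : Multiset n) → size M ≡ ∑ (lookup M)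
size≡∑lookup []      = refl
size≡∑lookup (m ∷ M) = cong (m +_) (size≡∑lookup M)

∑[v≟ᵇ_] : ∀ (v : Fin n) → ∑ [ v ≟ᵇ_] ≡ 1
∑[v≟ᵇ_] {suc n} zero    = cong suc (sum-replicate-zero n)
∑[v≟ᵇ_]         (suc v) = ∑[v≟ᵇ_] v

∑inAt≡#jumps+#additions : ∀ (ss : List (Step n)) → ∑ (inAt ss) ≡ #jumps ss + #additions ss
∑inAt≡#jumps+#additions {n} []     = sum-replicate-zero n
∑inAt≡#jumps+#additions (remove _ ∷ ss) = ∑inAt≡#jumps+#additions ss
∑inAt≡#jumps+#additions (add v ∷ ss) = begin
  ∑ (λ w → [ v ≟ᵇ w ] + inAt ss w)  ≡⟨ ∑-distrib-+ [ v ≟ᵇ_] (inAt ss) ⟩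
  ∑ [ v ≟ᵇ_] + ∑ (inAt ss)           ≡⟨ cong₂ _+_ (∑[v≟ᵇ_] v) (∑inAt≡#jumps+#additions ss) ⟩
  suc (#jumps ss + #additions ss)    ≡⟨ +-suc (#jumps ss) (#additions ss) ⟨
  #jumps ss + suc (#additions ss)    ∎
  where open ≡-Reasoning
∑inAt≡#jumps+#additions (jump _ v _ ∷ ss) =
  trans (∑-distrib-+ [ v ≟ᵇ_] (inAt ss)) (cong₂ _+_ (∑[v≟ᵇ_] v) (∑inAt≡#jumps+#additions ss))

∣support∪support∣≤1+k : ∀ {M M′ : Multiset n} → size M ≤ k → RelaxedMove k M M′ →
                         ∣ support M ∪ support M′ ∣ ≤ suc k
∣support∪support∣≤1+k {n} {k} {M} size≤k (ss , _ , refl , _ , #jumps+#additions≤) = begin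
  ∣ support M ∪ support M′ ∣            ≤⟨ p⊆q⇒∣p∣≤∣q∣ support-M∪M′⊆support-M+in ⟩
  ∣ support M+in ∣                      ≤⟨ ∣support∣≤size M+in ⟩
  size M+in                             ≡⟨ size≡∑lookup M+in ⟩
  ∑ (lookup M+in)                       ≡⟨ sum-cong-≗ (lookup∘tabulate M+in-at) ⟩
  ∑ M+in-at                             ≡⟨ ∑-distrib-+ (lookup M) (inAt ss) ⟩
  ∑ (lookup M) + ∑ (inAt ss)            ≡⟨ cong₂ _+_ (sym (size≡∑lookup M))
                                                     (∑inAt≡#jumps+#additions ss) ⟩
  size M + (#jumps ss + #additions ss)  ≤⟨ +-monoʳ-≤ (size M) #jumps+#additions≤ ⟩
  size M + suc (k ∸ size M)             ≡⟨ +-suc (size M) (k ∸ size M) ⟩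
  suc (size M + (k ∸ size M))           ≡⟨ cong suc (m+[n∸m]≡n size≤k) ⟩
  suc k                                 ∎
  where
  open ≤-Reasoning
  M+in-at : Fin n → ℕ
  M+in-at w = lookup M w + inAt ss w
  M′ M+in : Multiset n
  M′   = tabulate (λ w → M+in-at w ∸ outAt ss w)
  M+in = tabulate M+in-at
  M≤M+in : ∀ w → lookup M w ≤ lookup M+in w
  M≤M+in w = subst (lookup M w ≤_) (sym (lookup∘tabulate M+in-at w)) (m≤m+n _ _)
  M′≤M+in : ∀ w → lookup M′ w ≤ lookup M+in w
  M′≤M+in w rewrite lookup∘tabulate (λ w → M+in-at w ∸ outAt ss w) w
                  | lookup∘tabulate M+in-at w = m∸n≤m _ (outAt ss w)
  support-M∪M′⊆support-M+in : support M ∪ support M′ ⊆ support M+in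
  support-M∪M′⊆support-M+in = ∪-least (support-mono M≤M+in) (support-mono M′≤M+in)

module _ {A : Subset n} {u v : Fin n} (u∈A : u ∈ A) (v∉A : v ∉ A) where

  private
    u≢v : u ≢ v
    u≢v refl = v∉A u∈A

    tokens-balance : ∀ w → lookup (toMultiset (moveToken A u v)) w + [ u ≟ᵇ w ]
                         ≡ lookup (toMultiset A) w + [ v ≟ᵇ w ]
    tokens-balance w
      rewrite lookup-map w (λ b → if b then 1 else 0) (moveToken A u v)
            | lookup-map w (λ b → if b then 1 else 0) A
      with v ≟ w | u ≟ w
    ... | yes refl | yes u≡v = contradiction u≡v u≢v
    ... | yes refl | no _
      rewrite lookup∘update v (A [ u ]≔ outside) inside | x∉p⇒lookup≡outside v∉A = refl
    ... | no v≢w | yes refl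
      rewrite lookup∘update′ (v≢w ∘ sym) (A [ u ]≔ outside) inside | lookup∘update u A outside
            | []=⇒lookup u∈A = refl
    ... | no v≢w | no u≢w
      rewrite lookup∘update′ (v≢w ∘ sym) (A [ u ]≔ outside) inside
            | lookup∘update′ (u≢w ∘ sym) A outside = refl

  moveToken-RelaxedMove : RelaxedMove k (toMultiset A) (toMultiset (moveToken A u v))
  moveToken-RelaxedMove = jump u v u≢v ∷ [] , out≤ , balance , z≤n , s≤s z≤n
    where
    out≤ : ∀ w → [ u ≟ᵇ w ] + 0 ≤ lookup (toMultiset A) w
    out≤ w with u ≟ w
    ... | yes refl
      rewrite lookup-map u (λ b → if b then 1 else 0) A | []=⇒lookup u∈A = ≤-refl
    ... | no _ = z≤n
    balance : toMultiset (moveToken A u v)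
            ≡ tabulate (λ w → lookup (toMultiset A) w + ([ v ≟ᵇ w ] + 0) ∸ ([ u ≟ᵇ w ] + 0))
    balance = trans (sym (tabulate∘lookup _)) (tabulate-cong λ w → begin
      lookup (toMultiset (moveToken A u v)) w
        ≡⟨ m+n∸n≡m _ [ u ≟ᵇ w ] ⟨
      lookup (toMultiset (moveToken A u v)) w + [ u ≟ᵇ w ] ∸ [ u ≟ᵇ w ]
        ≡⟨ cong (_∸ [ u ≟ᵇ w ]) (tokens-balance w) ⟩
      lookup (toMultiset A) w + [ v ≟ᵇ w ] ∸ [ u ≟ᵇ w ]
        ≡⟨ cong₂ (λ i o → lookup (toMultiset A) w + i ∸ o)
                 (+-identityʳ [ v ≟ᵇ w ]) (+-identityʳ [ u ≟ᵇ w ]) ⟨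
      lookup (toMultiset A) w + ([ v ≟ᵇ w ] + 0) ∸ ([ u ≟ᵇ w ] + 0)
        ∎)
      where open ≡-Reasoning

size-source : ∀ {G : Graph n} {M N} → RelaxedSeq G k M N → size M ≤ k
size-source (done _ size≤k)       = size≤k
size-source (step _ size≤k _ _)   = size≤k

RelaxedSeq⇒TJReachesSuperset : ∀ {G : Graph n} {M N} → RelaxedSeq G k M N →
                               ∀ A → support M ⊆ A → ∣ A ∣ ≡ k → TJReachesSuperset G k A (support N)
RelaxedSeq⇒TJReachesSuperset (done _ _) A M⊆A ∣A∣≡k = A , M⊆A , ∣A∣≡k , ε
RelaxedSeq⇒TJReachesSuperset {G = G} (step {M} {M′} cov size≤k move rest) A M⊆A ∣A∣≡k
  with reachSuperset G (Equivalence.to (IsVertexCoverᴹ⇔IsVertexCover-support G M) cov)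
                       (∣support∪support∣≤1+k {M = M} size≤k move)
                       (≤-trans (∣support∣≤size M′) (size-source rest))
                       A M⊆A ∣A∣≡k
... | A′ , M′⊆A′ , ∣A′∣≡k , path with RelaxedSeq⇒TJReachesSuperset rest A′ M′⊆A′ ∣A′∣≡k
...   | B , N⊆B , ∣B∣≡k , path′ = B , N⊆B , ∣B∣≡k , path ◅◅ path′

toMultiset-IsVertexCoverᴹ : ∀ {G : Graph n} {A} →
                            IsVertexCover G A → IsVertexCoverᴹ G (toMultiset A)
toMultiset-IsVertexCoverᴹ {G = G} {A} cov =
  Equivalence.from (IsVertexCoverᴹ⇔IsVertexCover-support G (toMultiset A))
                   (subst (IsVertexCover G) (sym (support-toMultiset A)) cov)

TJSeq⇒RelaxedSeq : ∀ {G : Graph n} {A C} → TJSeq G A C → ∣ A ∣ ≡ k →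
                   RelaxedSeq G k (toMultiset A) (toMultiset C)
TJSeq⇒RelaxedSeq {G = G} {A = A} (done cov) ∣A∣≡k =
  done (toMultiset-IsVertexCoverᴹ {G = G} cov) (≤-reflexive (trans (size-toMultiset A) ∣A∣≡k))
TJSeq⇒RelaxedSeq {G = G} {A = A} (step cov (u , v , u∈A , v∉A , refl) rest) ∣A∣≡k =
  step (toMultiset-IsVertexCoverᴹ {G = G} cov) (≤-reflexive (trans (size-toMultiset A) ∣A∣≡k))
       (moveToken-RelaxedMove u∈A v∉A)
       (TJSeq⇒RelaxedSeq rest (trans (∣moveToken∣ u∈A v∉A) ∣A∣≡k))

lemma5 : ∀ {n} (G : Graph n) (Vs Vt : Subset n) →
    IsVertexCover G Vs → IsVertexCover G Vt → ∣ Vs ∣ ≡ ∣ Vt ∣ →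
    RelaxedSeq G ∣ Vs ∣ (toMultiset Vs) (toMultiset Vt) ⇔ TJSeq G Vs Vt
-- That Vs is a vertex cover is already certified by either sequence.
lemma5 G Vs Vt _ Vt-cover ∣Vs∣≡∣Vt∣ = mk⇔ relaxed⇒TJ (λ seq → TJSeq⇒RelaxedSeq seq refl)
  where
  relaxed⇒TJ : RelaxedSeq G ∣ Vs ∣ (toMultiset Vs) (toMultiset Vt) → TJSeq G Vs Vt
  relaxed⇒TJ seq
    with RelaxedSeq⇒TJReachesSuperset seq Vs (⊆-reflexive (support-toMultiset Vs)) refl
  ... | B , Vt′⊆B , ∣B∣≡∣Vs∣ , path =
    TJPath-◅◅-TJSeq path (subst (λ X → TJSeq G X Vt) (sym B≡Vt) (done Vt-cover))
    where
    Vt⊆B : Vt ⊆ B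
    Vt⊆B = ⊆-trans (⊆-reflexive (sym (support-toMultiset Vt))) Vt′⊆B
    B≡Vt : B ≡ Vt
    B≡Vt = ⊆-antisym (p⊆q∧∣q∣≤∣p∣⇒q⊆p Vt⊆B (≤-reflexive (trans ∣B∣≡∣Vs∣ ∣Vs∣≡∣Vt∣))) Vt⊆B
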